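{- Let $G$ be a connected graph with $n$ vertices and $g\ge0$ an integer. If $\kappa^g(G)$ exists, then $t^{g}(G)\le \min\{c^g(G)-1,\ n-g-2\}$. Moreover, the bound is sharp.
   Context: For $G=(V,E)$ and $F\subseteq V$, $F$ is a $g$-good-neighbor conditional faulty set if every vertex of $V\setminus F$ has at least $g$ neighbors in $V\setminus F$; it is a $g$-good-neighbor cut if moreover $G-F$ is disconnected. $\kappa^g(G)$ is the minimum size of a $g$-good-neighbor cut (it exists if such a cut exists). PMC model: distinct $F_1,F_2\subseteq V$ are distinguishable iff there exist $u\in F_1\triangle F_2$, $v\in V\setminus(F_1\cup F_2)$ with $uv\in E$. $t^g(G)$ is the maximum $t$ such that every pair of distinct $g$-good-neighbor conditional faulty sets of size at most $t$ is distinguishable. gc number: for a $g$-good-neighbor cut $X$ and component $C$ of $G-X$, $C$ is splittable if $V(C)$ partitions into nonempty $A,B$ with $\delta(G[A]),\delta(G[B])\ge g$; among such partitions with $|A|\ge|B|$ minimizing $|A|-|B|$ set $a(C)=|A|$. $a(X)=\min a(C)$ over splittable components, $c(X)=$ minimum order of a non-splittable component (minima over empty sets are $+\infty$), and $c^g(G)=\min_X\{|X|+\min\{a(X),c(X)\}\}$ over all $g$-good-neighbor cuts $X$. -}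

module Defs where

open import Data.Nat using (ℕ; _≤_; _+_)
open import Data.Bool using (Bool; true; false)
open import Data.Fin using (Fin)
open import Data.Fin.Subset using (Subset; _∈_; _∉_; ∁; _∩_; ∣_∣)
open import Data.Vec using (tabulate)
open import Data.Product using (Σ; ∃; _×_; _,_)
open import Data.Sum using (_⊎_)
open import Relation.Nullary using (¬_)
open import Relation.Binary.PropositionalEquality using (_≡_; _≢_)

record Graph (n : ℕ) : Set where
  field
    adj    : Fin n → Fin n → Bool
    sym    : ∀ u v → adj u v ≡ adj v u
    irrefl : ∀ v → adj v v ≡ false
open Graph public

module _ {n : ℕ} (G : Graph n) where

  Adj : Fin n → Fin n → Set
  Adj u v = adj G u v ≡ true

  N : Fin n → Subset n
  N v = tabulate (adj G v)

  -- Reach S u v : there is a u–v path all of whose vertices lie in S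
  -- (u itself is assumed to lie in S by the users of this relation).
  data Reach (S : Subset n) : Fin n → Fin n → Set where
    here : ∀ {u} → Reach S u u
    step : ∀ {u w v} → Adj u w → w ∈ S → Reach S w v → Reach S u v

  Full : Subset n
  Full = tabulate (λ _ → true)

  Connected : Set
  Connected = ∀ u v → Reach Full u v

  MinDegAtLeast : Subset n → ℕ → Set
  MinDegAtLeast A g = ∀ v → v ∈ A → g ≤ ∣ N v ∩ A ∣

  GoodFaulty : ℕ → Subset n → Set
  GoodFaulty g F = ∀ v → v ∉ F → g ≤ ∣ N v ∩ ∁ F ∣

  Disconnected- : Subset n → Set
  Disconnected- F = Σ (Fin n) λ u → Σ (Fin n) λ v →
    u ∉ F × v ∉ F × ¬ Reach (∁ F) u v

  GoodCut : ℕ → Subset n → Set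
  GoodCut g F = GoodFaulty g F × Disconnected- F

  KappaExists : ℕ → Set
  KappaExists g = ∃ λ X → GoodCut g X

  Distinguishable : Subset n → Subset n → Set
  Distinguishable F₁ F₂ = Σ (Fin n) λ u → Σ (Fin n) λ v →
    ((u ∈ F₁ × u ∉ F₂) ⊎ (u ∈ F₂ × u ∉ F₁)) × v ∉ F₁ × v ∉ F₂ × Adj u v

  Diagnosable : ℕ → ℕ → Set
  Diagnosable g t = ∀ F₁ F₂ → GoodFaulty g F₁ → GoodFaulty g F₂ →
    ∣ F₁ ∣ ≤ t → ∣ F₂ ∣ ≤ t → F₁ ≢ F₂ → Distinguishable F₁ F₂

  IsTg : ℕ → ℕ → Set
  IsTg g t = Diagnosable g t × (∀ t' → Diagnosable g t' → t' ≤ t)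

  Component : Subset n → Subset n → Set
  Component X C =
    (∀ v → v ∈ C → v ∉ X) ×
    (∃ λ v → v ∈ C) ×
    (∀ u v → u ∈ C → v ∈ C → Reach C u v) ×
    (∀ u w → u ∈ C → Adj u w → w ∉ X → w ∈ C)

  GoodPartition : ℕ → Subset n → Subset n → Subset n → Set
  GoodPartition g C A B =
    (∀ v → v ∈ C → v ∈ A ⊎ v ∈ B) ×
    (∀ v → v ∈ A → v ∈ C) ×
    (∀ v → v ∈ B → v ∈ C) ×
    (∀ v → v ∈ A → v ∉ B) ×
    (∃ λ v → v ∈ A) × (∃ λ v → v ∈ B) ×
    MinDegAtLeast A g × MinDegAtLeast B g

  Splittable : ℕ → Subset n → Set
  Splittable g C = ∃ λ A → ∃ λ B → GoodPartition g C A B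

  -- a(C) = a : among good partitions with |A| ≥ |B| minimizing |A| - |B|, |A| = a
  -- (|A| - |B| is compared as |A| + |B'| ≤ |A'| + |B|, avoiding truncated subtraction;
  --  this is exact since |B| ≤ |A| and |B'| ≤ |A'|.)
  IsA : ℕ → Subset n → ℕ → Set
  IsA g C a = ∃ λ A → ∃ λ B →
    GoodPartition g C A B × ∣ B ∣ ≤ ∣ A ∣ × ∣ A ∣ ≡ a ×
    (∀ A' B' → GoodPartition g C A' B' → ∣ B' ∣ ≤ ∣ A' ∣ →
       ∣ A ∣ + ∣ B' ∣ ≤ ∣ A' ∣ + ∣ B ∣)

  -- w is a candidate value for min{a(X), c(X)} contributed by the component C of G - X:
  -- a(C) if C is splittable, |C| if C is not splittable.
  CompValue : ℕ → Subset n → Subset n → ℕ → Set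
  CompValue g X C w = Component X C ×
    ((Splittable g C × IsA g C w) ⊎ (¬ Splittable g C × w ≡ ∣ C ∣))

  -- c is c^g(G) = min over g-good-neighbor cuts X of |X| + min{a(X), c(X)}
  IsCg : ℕ → ℕ → Set
  IsCg g c =
    (∃ λ X → ∃ λ C → ∃ λ w → GoodCut g X × CompValue g X C w × c ≡ ∣ X ∣ + w) ×
    (∀ X C w → GoodCut g X → CompValue g X C w → c ≤ ∣ X ∣ + w)

-- Both bounds come from a pair of distinct g-good-neighbor faulty sets F₁, F₂ that no PMC
-- test separates.  Let a cut X attain c^g(G) through a component C.  Take X and X ∪ C if C
-- is not splittable, and X ∪ A, X ∪ B for the balanced split (A , B) of C otherwise: both
-- contain X, their symmetric difference lies in C and C ⊆ F₁ ∪ F₂, so a test from F₁ △ F₂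
-- only reaches C ⊆ F₁ ∪ F₂.  Both have size at most c^g(G), whence t^g(G) < c^g(G).  The
-- sets ∁ C and X ∪ C cover V, so they are indistinguishable, and each misses a vertex
-- which, with its g good neighbours, lies outside the set; so both have size at most
-- n - g - 1.  The path 0 - 1 - 2 with g = 0 attains both bounds.
module Submission where

open import Defs hiding (sym)
open import Data.Bool using (true; _≟_)
open import Data.Fin using (Fin; toℕ)
open import Data.Fin.Patterns using (0F; 1F; 2F)
open import Data.Fin.Properties using (any?; all?)
open import Data.Fin.Subset
  using (Subset; inside; outside; _∈_; _∉_; _⊆_; _⊂_; ∁; _∩_; _∪_; ∣_∣; ⁅_⁆; ⊥)
open import Data.Fin.Subset.Properties
  using (_∈?_; anySubset?; p⊆q⇒∣p∣≤∣q∣; p⊂q⇒∣p∣<∣q∣; x∈p⇒∣p-x∣<∣p∣; ∣p∣≤∣x∷p∣;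
         ∣p∣≤n; ∣∁p∣≡n∸∣p∣; x∈p∩q⁺; x∈p∩q⁻; x∈p∪q⁺; x∈p∪q⁻; p⊆p∪q; q⊆p∪q;
         x∈p⇒x∉∁p; x∈∁p⇒x∉p; x∉p⇒x∈∁p; x∉∁p⇒x∈p; x∈⁅x⁆; x∈⁅y⁆⇒x≡y; ∉⊥)
open import Data.Nat using (ℕ; suc; _+_; _∸_; _⊓_; _≤_; _<_; z≤n; s≤s; _≤?_; ∣_-_∣; _≡ᵇ_)
open import Data.Nat.Properties
  using (≤-trans; ≤-reflexive; ≤-pred; ≤-<-trans; ≰⇒>; +-comm; +-suc; +-mono-≤; +-monoʳ-≤;
         m≤m+n; m+[n∸m]≡n; m+n≤o⇒m≤o∸n; m+n≤o⇒n≤o; m≤o∸n⇒m+n≤o; ∣-∣-comm; ∣n-n∣≡0)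
open import Data.Product using (Σ; ∃; _×_; _,_; proj₁; proj₂)
open import Data.Sum using (_⊎_; inj₁; inj₂; [_,_]; map₂; swap) renaming (map to ⊎-map)
open import Data.Vec using ([]; _∷_)
open import Data.Vec.Properties using (≡-dec; lookup⇒[]=; []=⇒lookup; lookup∘tabulate)
open import Relation.Nullary
  using (¬_; Dec; yes; no; contradiction; ¬?; _×-dec_; _⊎-dec_; _→-dec_; map′;
         decidable-stable; from-yes)
open import Relation.Unary using (Pred; Decidable)
open import Relation.Binary.PropositionalEquality
  using (_≡_; _≢_; ≢-sym; refl; sym; trans; cong; subst)

∣p∪q∣≤∣p∣+∣q∣ : ∀ {n} (p q : Subset n) → ∣ p ∪ q ∣ ≤ ∣ p ∣ + ∣ q ∣
∣p∪q∣≤∣p∣+∣q∣ []            []            = z≤n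
∣p∪q∣≤∣p∣+∣q∣ (inside ∷ p)  (x ∷ q)       =
  s≤s (≤-trans (∣p∪q∣≤∣p∣+∣q∣ p q) (+-monoʳ-≤ ∣ p ∣ (∣p∣≤∣x∷p∣ x q)))
∣p∪q∣≤∣p∣+∣q∣ (outside ∷ p) (inside ∷ q)  =
  ≤-trans (s≤s (∣p∪q∣≤∣p∣+∣q∣ p q)) (≤-reflexive (sym (+-suc ∣ p ∣ ∣ q ∣)))
∣p∪q∣≤∣p∣+∣q∣ (outside ∷ p) (outside ∷ q) = ∣p∪q∣≤∣p∣+∣q∣ p q

x∈p⇒0<∣p∣ : ∀ {n} {p : Subset n} {x} → x ∈ p → 0 < ∣ p ∣
x∈p⇒0<∣p∣ x∈p = ≤-<-trans z≤n (x∈p⇒∣p-x∣<∣p∣ x∈p)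

x∈p∪q∧x∉p⇒x∈q : ∀ {n} {p q : Subset n} {x} → x ∈ p ∪ q → x ∉ p → x ∈ q
x∈p∪q∧x∉p⇒x∈q {p = p} {q} x∈p∪q x∉p =
  [ (λ x∈p → contradiction x∈p x∉p) , (λ x∈q → x∈q) ] (x∈p∪q⁻ p q x∈p∪q)

x∉p∪q⇒x∉p : ∀ {n} {p q : Subset n} {x} → x ∉ p ∪ q → x ∉ p
x∉p∪q⇒x∉p x∉p∪q x∈p = x∉p∪q (x∈p∪q⁺ (inj₁ x∈p))

x∉p∪q⇒x∉q : ∀ {n} {p q : Subset n} {x} → x ∉ p ∪ q → x ∉ q
x∉p∪q⇒x∉q x∉p∪q x∈q = x∉p∪q (x∈p∪q⁺ (inj₂ x∈q))

x∉p∧x∉q⇒x∉p∪q : ∀ {n} {p q : Subset n} {x} → x ∉ p → x ∉ q → x ∉ p ∪ q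
x∉p∧x∉q⇒x∉p∪q {p = p} {q} x∉p x∉q x∈p∪q = [ x∉p , x∉q ] (x∈p∪q⁻ p q x∈p∪q)

∪-monoʳ-⊆ : ∀ {n} (r : Subset n) {p q} → p ⊆ q → r ∪ p ⊆ r ∪ q
∪-monoʳ-⊆ r {p} p⊆q x∈r∪p = x∈p∪q⁺ (map₂ p⊆q (x∈p∪q⁻ r p x∈r∪p))

x≢y⇒x∉⁅y⁆ : ∀ {n} {x : Fin n} y → x ≢ y → x ∉ ⁅ y ⁆
x≢y⇒x∉⁅y⁆ y x≢y x∈⁅y⁆ = x≢y (x∈⁅y⁆⇒x≡y y x∈⁅y⁆)

x∈p∧x∉q⇒p≢q : ∀ {n} {p q : Subset n} {x} → x ∈ p → x ∉ q → p ≢ q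
x∈p∧x∉q⇒p≢q x∈p x∉q p≡q = x∉q (subst (_ ∈_) p≡q x∈p)

allSubset? : ∀ {n ℓ} {P : Pred (Subset n) ℓ} → Decidable P → Dec (∀ p → P p)
allSubset? P? = map′
  (λ ∄¬P p → decidable-stable (P? p) (λ ¬Pp → ∄¬P (p , ¬Pp)))
  (λ ∀P (p , ¬Pp) → ¬Pp (∀P p))
  (¬? (anySubset? (λ p → ¬? (P? p))))

module _ {n : ℕ} (G : Graph n) where

  ∈N⇒Adj : ∀ {v w} → w ∈ N G v → Adj G v w
  ∈N⇒Adj {v} {w} w∈Nv = trans (sym (lookup∘tabulate (adj G v) w)) ([]=⇒lookup w∈Nv)

  Adj-sym : ∀ {u v} → Adj G u v → Adj G v u
  Adj-sym {u} {v} uv = trans (Graph.sym G v u) uv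

  v∉N[v] : ∀ v → v ∉ N G v
  v∉N[v] v v∈N[v] = contradiction (trans (sym (∈N⇒Adj v∈N[v])) (irrefl G v)) λ ()

  stepFull : ∀ {u w v} → Adj G u w → Reach G (Full G) w v → Reach G (Full G) u v
  stepFull {w = w} uw = step uw (lookup⇒[]= w (Full G) (lookup∘tabulate _ w))

  ∣N∩S∣≤∣N∩∁F∣ : ∀ {v} (S F : Subset n) → (∀ {w} → Adj G v w → w ∈ S → w ∉ F) →
                 ∣ N G v ∩ S ∣ ≤ ∣ N G v ∩ ∁ F ∣
  ∣N∩S∣≤∣N∩∁F∣ {v} S F S∌F = p⊆q⇒∣p∣≤∣q∣ λ w∈N∩S →
    let w∈N , w∈S = x∈p∩q⁻ (N G v) S w∈N∩S
    in x∈p∩q⁺ (w∈N , x∉p⇒x∈∁p (S∌F (∈N⇒Adj w∈N) w∈S))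

  goodFaulty⇒∣F∣+1+g≤n : ∀ {g F y} → GoodFaulty G g F → y ∉ F → ∣ F ∣ + suc g ≤ n
  goodFaulty⇒∣F∣+1+g≤n {g} {F} {y} gf y∉F =
    subst (∣ F ∣ + suc g ≤_) (m+[n∸m]≡n (∣p∣≤n F))
      (+-monoʳ-≤ ∣ F ∣ (subst (suc g ≤_) (∣∁p∣≡n∸∣p∣ F)
        (≤-<-trans (gf y y∉F) (p⊂q⇒∣p∣<∣q∣ N∩∁F⊂∁F))))
    where
    N∩∁F⊂∁F : N G y ∩ ∁ F ⊂ ∁ F
    N∩∁F⊂∁F = (λ x∈ → proj₂ (x∈p∩q⁻ (N G y) (∁ F) x∈))
            , y , x∉p⇒x∈∁p y∉F , (λ y∈ → v∉N[v] y (proj₁ (x∈p∩q⁻ (N G y) (∁ F) y∈)))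

  reach∧¬reach∁⇒∃∈ : ∀ {X u v} → Reach G (Full G) u v → ¬ Reach G (∁ X) u v →
                      ∃ λ x → x ∈ X
  reach∧¬reach∁⇒∃∈ here ¬reach = contradiction here ¬reach
  reach∧¬reach∁⇒∃∈ {X} (step {w = w} uw _ path) ¬reach with w ∈? X
  ... | yes w∈X = w , w∈X
  ... | no w∉X  = reach∧¬reach∁⇒∃∈ path (λ path′ → ¬reach (step uw (x∉p⇒x∈∁p w∉X) path′))

  Reach-mono : ∀ {S S′ u v} → S ⊆ S′ → Reach G S u v → Reach G S′ u v
  Reach-mono S⊆S′ here              = here
  Reach-mono S⊆S′ (step uw w∈S path) = step uw (S⊆S′ w∈S) (Reach-mono S⊆S′ path)

  goodCut⇒0<∣X∣ : ∀ {g X} → Connected G → GoodCut G g X → 0 < ∣ X ∣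
  goodCut⇒0<∣X∣ conn (_ , u , v , _ , _ , ¬reach) =
    let _ , x∈X = reach∧¬reach∁⇒∃∈ (conn u v) ¬reach in x∈p⇒0<∣p∣ x∈X

  compValue⇒0<w : ∀ {g X C w} → CompValue G g X C w → 0 < w
  compValue⇒0<w (_ , inj₁ (_ , A , _ , (_ , _ , _ , _ , (_ , a∈A) , _) , _ , refl , _)) =
    x∈p⇒0<∣p∣ a∈A
  compValue⇒0<w ((_ , (_ , x∈C) , _) , inj₂ (_ , refl)) = x∈p⇒0<∣p∣ x∈C

  component-outside : ∀ {X C} → Disconnected- G X → Component G X C → ∃ λ y → y ∉ X ∪ C
  component-outside {X} {C} (u , v , u∉X , v∉X , ¬reach) (C∌X , _ , C-connected , _)
    with u ∈? C | v ∈? C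
  ... | no u∉C  | _       = u , x∉p∧x∉q⇒x∉p∪q u∉X u∉C
  ... | yes _   | no v∉C  = v , x∉p∧x∉q⇒x∉p∪q v∉X v∉C
  ... | yes u∈C | yes v∈C =
    contradiction (Reach-mono (λ x∈C → x∉p⇒x∈∁p (C∌X _ x∈C)) (C-connected u v u∈C v∈C))
                  ¬reach

  -- Off C, a neighbour outside X cannot lie in A ⊆ C, since C is closed in G - X.
  goodFaulty-∪ : ∀ {g X C A B} → GoodFaulty G g X → Component G X C →
                 A ⊆ C → C ⊆ A ∪ B → (∀ {v} → v ∈ B → v ∉ X ∪ A) → MinDegAtLeast G B g →
                 GoodFaulty G g (X ∪ A)
  goodFaulty-∪ {g} {X} {C} {A} {B} gfX (_ , _ , _ , C-closed) A⊆C C⊆A∪B B∌X∪A δB v v∉X∪A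
    with v ∈? C
  ... | yes v∈C = ≤-trans (δB v v∈B) (∣N∩S∣≤∣N∩∁F∣ B (X ∪ A) (λ _ → B∌X∪A))
    where
    v∈B : v ∈ B
    v∈B = x∈p∪q∧x∉p⇒x∈q (C⊆A∪B v∈C) (x∉p∪q⇒x∉q v∉X∪A)
  ... | no v∉C = ≤-trans (gfX v v∉X) (∣N∩S∣≤∣N∩∁F∣ (∁ X) (X ∪ A) ∁X∌X∪A)
    where
    v∉X : v ∉ X
    v∉X = x∉p∪q⇒x∉p v∉X∪A
    ∁X∌X∪A : ∀ {w} → Adj G v w → w ∈ ∁ X → w ∉ X ∪ A
    ∁X∌X∪A vw w∈∁X w∈X∪A =
      v∉C (C-closed _ v (A⊆C (x∈p∪q∧x∉p⇒x∈q w∈X∪A (x∈∁p⇒x∉p w∈∁X))) (Adj-sym vw) v∉X)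

  goodFaulty-∪-component : ∀ {g X C} → GoodFaulty G g X → Component G X C →
                           GoodFaulty G g (X ∪ C)
  goodFaulty-∪-component {C = C} gfX compC =
    goodFaulty-∪ {B = ⊥} gfX compC (λ x∈C → x∈C) (p⊆p∪q ⊥)
      (λ x∈⊥ → contradiction x∈⊥ ∉⊥) (λ _ x∈⊥ → contradiction x∈⊥ ∉⊥)

  goodFaulty-∁-component : ∀ {g X C} → GoodFaulty G g X → Component G X C → GoodFaulty G g (∁ C)
  goodFaulty-∁-component {X = X} {C} gfX (C∌X , _ , _ , C-closed) v v∉∁C =
    ≤-trans (gfX v (C∌X v v∈C)) (∣N∩S∣≤∣N∩∁F∣ (∁ X) (∁ C) λ vw w∈∁X →
      x∈p⇒x∉∁p (C-closed v _ v∈C vw (x∈∁p⇒x∉p w∈∁X)))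
    where
    v∈C : v ∈ C
    v∈C = x∉∁p⇒x∈p v∉∁C

  goodPartition-goodFaulty : ∀ {g X C A B} → GoodFaulty G g X → Component G X C →
                             GoodPartition G g C A B →
                             GoodFaulty G g (X ∪ A) × GoodFaulty G g (X ∪ B)
  goodPartition-goodFaulty {X = X} {C} {A} {B} gfX compC@(C∌X , _)
    (C⊆A⊎B , A⊆C , B⊆C , A∌B , _ , _ , δA , δB) =
    goodFaulty-∪ gfX compC (A⊆C _) (λ v∈C → x∈p∪q⁺ (C⊆A⊎B _ v∈C)) B∌X∪A δB ,
    goodFaulty-∪ gfX compC (B⊆C _) (λ v∈C → x∈p∪q⁺ (swap (C⊆A⊎B _ v∈C))) A∌X∪B δA
    where
    B∌X∪A : ∀ {v} → v ∈ B → v ∉ X ∪ A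
    B∌X∪A v∈B = x∉p∧x∉q⇒x∉p∪q (C∌X _ (B⊆C _ v∈B)) (λ v∈A → A∌B _ v∈A v∈B)
    A∌X∪B : ∀ {v} → v ∈ A → v ∉ X ∪ B
    A∌X∪B v∈A = x∉p∧x∉q⇒x∉p∪q (C∌X _ (A⊆C _ v∈A)) (A∌B _ v∈A)

  component-indistinguishable : ∀ {X C F₁ F₂} → Component G X C →
    X ⊆ F₁ → X ⊆ F₂ → F₁ ⊆ X ∪ C → F₂ ⊆ X ∪ C → C ⊆ F₁ ∪ F₂ → ¬ Distinguishable G F₁ F₂
  component-indistinguishable {X} {C} {F₁} {F₂} (_ , _ , _ , C-closed)
    X⊆F₁ X⊆F₂ F₁⊆X∪C F₂⊆X∪C C⊆F₁∪F₂ (u , v , u∈F₁△F₂ , v∉F₁ , v∉F₂ , uv) =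
    x∉p∧x∉q⇒x∉p∪q v∉F₁ v∉F₂
      (C⊆F₁∪F₂ (C-closed u v (u∈C u∈F₁△F₂) uv (λ v∈X → v∉F₁ (X⊆F₁ v∈X))))
    where
    u∈C : (u ∈ F₁ × u ∉ F₂) ⊎ (u ∈ F₂ × u ∉ F₁) → u ∈ C
    u∈C (inj₁ (u∈F₁ , u∉F₂)) = x∈p∪q∧x∉p⇒x∈q (F₁⊆X∪C u∈F₁) (λ u∈X → u∉F₂ (X⊆F₂ u∈X))
    u∈C (inj₂ (u∈F₂ , u∉F₁)) = x∈p∪q∧x∉p⇒x∈q (F₂⊆X∪C u∈F₂) (λ u∈X → u∉F₁ (X⊆F₁ u∈X))

  covering-indistinguishable : ∀ {F₁ F₂} → (∀ v → v ∈ F₁ ⊎ v ∈ F₂) → ¬ Distinguishable G F₁ F₂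
  covering-indistinguishable cover (_ , v , _ , v∉F₁ , v∉F₂ , _) with cover v
  ... | inj₁ v∈F₁ = v∉F₁ v∈F₁
  ... | inj₂ v∈F₂ = v∉F₂ v∈F₂

  diagnosable⇒< : ∀ {g t m F₁ F₂} → Diagnosable G g t →
    GoodFaulty G g F₁ → GoodFaulty G g F₂ → F₁ ≢ F₂ → ¬ Distinguishable G F₁ F₂ →
    ∣ F₁ ∣ ≤ m → ∣ F₂ ∣ ≤ m → t < m
  diagnosable⇒< {t = t} {m} diag gf₁ gf₂ F₁≢F₂ ¬dist ∣F₁∣≤m ∣F₂∣≤m with m ≤? t
  ... | no m≰t  = ≰⇒> m≰t
  ... | yes m≤t =
    contradiction (diag _ _ gf₁ gf₂ (≤-trans ∣F₁∣≤m m≤t) (≤-trans ∣F₂∣≤m m≤t) F₁≢F₂) ¬dist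

  diagnosable⇒<cutValue : ∀ {g t X C w} → Diagnosable G g t → GoodCut G g X →
                          CompValue G g X C w → t < ∣ X ∣ + w
  diagnosable⇒<cutValue {X = X} {C} diag (gfX , _) (compC@(C∌X , (x , x∈C) , _) , inj₂ (_ , refl)) =
    diagnosable⇒< diag gfX (goodFaulty-∪-component gfX compC)
      (≢-sym (x∈p∧x∉q⇒p≢q (q⊆p∪q X C x∈C) (C∌X x x∈C)))
      (component-indistinguishable compC (λ x∈X → x∈X) (p⊆p∪q C) (p⊆p∪q C) (λ x∈ → x∈)
         (λ x∈C′ → q⊆p∪q X (X ∪ C) (q⊆p∪q X C x∈C′)))
      (m≤m+n ∣ X ∣ ∣ C ∣) (∣p∪q∣≤∣p∣+∣q∣ X C)
  diagnosable⇒<cutValue {g} {X = X} {C} diag (gfX , _)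
    (compC@(C∌X , _) ,
     inj₁ (_ , A , B , part@(C⊆A⊎B , A⊆C , B⊆C , A∌B , (a , a∈A) , _) , ∣B∣≤∣A∣ , refl , _)) =
    diagnosable⇒< diag (proj₁ gfX∪A×gfX∪B) (proj₂ gfX∪A×gfX∪B)
      (x∈p∧x∉q⇒p≢q (q⊆p∪q X A a∈A) (x∉p∧x∉q⇒x∉p∪q (C∌X a (A⊆C a a∈A)) (A∌B a a∈A)))
      (component-indistinguishable compC (p⊆p∪q A) (p⊆p∪q B)
         (∪-monoʳ-⊆ X (A⊆C _)) (∪-monoʳ-⊆ X (B⊆C _))
         (λ v∈C → x∈p∪q⁺ (⊎-map (q⊆p∪q X A) (q⊆p∪q X B) (C⊆A⊎B _ v∈C))))
      (∣p∪q∣≤∣p∣+∣q∣ X A) (≤-trans (∣p∪q∣≤∣p∣+∣q∣ X B) (+-monoʳ-≤ ∣ X ∣ ∣B∣≤∣A∣))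
    where
    gfX∪A×gfX∪B : GoodFaulty G g (X ∪ A) × GoodFaulty G g (X ∪ B)
    gfX∪A×gfX∪B = goodPartition-goodFaulty gfX compC part

  diagnosable⇒t+g+2≤n : ∀ {g t X C} → Diagnosable G g t → GoodCut G g X → Component G X C →
                        t + g + 2 ≤ n
  diagnosable⇒t+g+2≤n {g} {t} {X} {C} diag (gfX , disconnected) compC@(_ , (x , x∈C) , _) =
    subst (_≤ n) (trans (cong suc (+-suc t g)) (+-comm 2 (t + g)))
      (m≤o∸n⇒m+n≤o (suc t) (m+n≤o⇒n≤o ∣ ∁ C ∣ ∣∁C∣+1+g≤n) t<n∸g)
    where
    gf∁C : GoodFaulty G g (∁ C)
    gf∁C = goodFaulty-∁-component gfX compC
    gfX∪C : GoodFaulty G g (X ∪ C)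
    gfX∪C = goodFaulty-∪-component gfX compC
    y∉X∪C : proj₁ (component-outside disconnected compC) ∉ X ∪ C
    y∉X∪C = proj₂ (component-outside disconnected compC)
    ∣∁C∣+1+g≤n : ∣ ∁ C ∣ + suc g ≤ n
    ∣∁C∣+1+g≤n = goodFaulty⇒∣F∣+1+g≤n gf∁C (x∈p⇒x∉∁p x∈C)
    ∣X∪C∣+1+g≤n : ∣ X ∪ C ∣ + suc g ≤ n
    ∣X∪C∣+1+g≤n = goodFaulty⇒∣F∣+1+g≤n gfX∪C y∉X∪C
    ∁C-or-X∪C : ∀ v → v ∈ ∁ C ⊎ v ∈ X ∪ C
    ∁C-or-X∪C v with v ∈? C
    ... | yes v∈C = inj₂ (q⊆p∪q X C v∈C)
    ... | no v∉C  = inj₁ (x∉p⇒x∈∁p v∉C)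
    t<n∸g : t < n ∸ suc g
    t<n∸g = diagnosable⇒< diag gf∁C gfX∪C
      (x∈p∧x∉q⇒p≢q (x∉p⇒x∈∁p (x∉p∪q⇒x∉q y∉X∪C)) y∉X∪C)
      (covering-indistinguishable ∁C-or-X∪C)
      (m+n≤o⇒m≤o∸n ∣ ∁ C ∣ ∣∁C∣+1+g≤n) (m+n≤o⇒m≤o∸n ∣ X ∪ C ∣ ∣X∪C∣+1+g≤n)

  goodFaulty? : ∀ g → Decidable (GoodFaulty G g)
  goodFaulty? g F = all? λ v → ¬? (v ∈? F) →-dec (g ≤? ∣ N G v ∩ ∁ F ∣)

  distinguishable? : ∀ F₁ F₂ → Dec (Distinguishable G F₁ F₂)
  distinguishable? F₁ F₂ = any? λ u → any? λ v →
    (((u ∈? F₁) ×-dec ¬? (u ∈? F₂)) ⊎-dec ((u ∈? F₂) ×-dec ¬? (u ∈? F₁))) ×-dec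
    ¬? (v ∈? F₁) ×-dec ¬? (v ∈? F₂) ×-dec (adj G u v ≟ true)

  diagnosable? : ∀ g t → Dec (Diagnosable G g t)
  diagnosable? g t = allSubset? λ F₁ → allSubset? λ F₂ →
    goodFaulty? g F₁ →-dec goodFaulty? g F₂ →-dec (∣ F₁ ∣ ≤? t) →-dec (∣ F₂ ∣ ≤? t) →-dec
    ¬? (≡-dec _≟_ F₁ F₂) →-dec distinguishable? F₁ F₂

path : (n : ℕ) → Graph n
path n = record
  { adj    = λ u v → ∣ toℕ u - toℕ v ∣ ≡ᵇ 1
  ; sym    = λ u v → cong (_≡ᵇ 1) (∣-∣-comm (toℕ u) (toℕ v))
  ; irrefl = λ v → cong (_≡ᵇ 1) (∣n-n∣≡0 (toℕ v))
  }

path₃-connected : Connected (path 3)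
path₃-connected 0F 0F = here
path₃-connected 0F 1F = stepFull (path 3) refl here
path₃-connected 0F 2F = stepFull (path 3) {w = 1F} refl (stepFull (path 3) refl here)
path₃-connected 1F 0F = stepFull (path 3) refl here
path₃-connected 1F 1F = here
path₃-connected 1F 2F = stepFull (path 3) refl here
path₃-connected 2F 0F = stepFull (path 3) {w = 1F} refl (stepFull (path 3) refl here)
path₃-connected 2F 1F = stepFull (path 3) refl here
path₃-connected 2F 2F = here

path₃-cut : GoodCut (path 3) 0 ⁅ 1F ⁆
path₃-cut = (λ _ _ → z≤n) , 0F , 2F , x≢y⇒x∉⁅y⁆ 1F (λ ()) , x≢y⇒x∉⁅y⁆ 1F (λ ()) , 0↛2
  where
  0↛2 : ¬ Reach (path 3) (∁ ⁅ 1F ⁆) 0F 2F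
  0↛2 (step {w = 1F} _ 1∈∁ _) = x∈p⇒x∉∁p (x∈⁅x⁆ 1F) 1∈∁

∈⁅0F⁆ : ∀ {v} → v ∈ ⁅ 0F ⁆ → v ≡ 0F
∈⁅0F⁆ = x∈⁅y⁆⇒x≡y {n = 3} 0F

path₃-component : Component (path 3) ⁅ 1F ⁆ ⁅ 0F ⁆
path₃-component = disjoint , (0F , x∈⁅x⁆ 0F) , connected , closed
  where
  disjoint : ∀ v → v ∈ ⁅ 0F ⁆ → v ∉ ⁅ 1F ⁆
  disjoint v v∈ with ∈⁅0F⁆ v∈
  ... | refl = x≢y⇒x∉⁅y⁆ 1F (λ ())
  connected : ∀ u v → u ∈ ⁅ 0F ⁆ → v ∈ ⁅ 0F ⁆ → Reach (path 3) ⁅ 0F ⁆ u v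
  connected u v u∈ v∈ with ∈⁅0F⁆ u∈ | ∈⁅0F⁆ v∈
  ... | refl | refl = here
  closed : ∀ u w → u ∈ ⁅ 0F ⁆ → Adj (path 3) u w → w ∉ ⁅ 1F ⁆ → w ∈ ⁅ 0F ⁆
  closed u w u∈ with ∈⁅0F⁆ u∈
  closed _ 0F _ | refl = λ ()
  closed _ 1F _ | refl = λ _ 1∉ → contradiction (x∈⁅x⁆ 1F) 1∉
  closed _ 2F _ | refl = λ ()

path₃-unsplittable : ¬ Splittable (path 3) 0 ⁅ 0F ⁆
path₃-unsplittable (A , B , _ , A⊆C , B⊆C , A∌B , (a , a∈A) , (b , b∈B) , _) =
  A∌B a a∈A (subst (_∈ B) (trans (∈⁅0F⁆ (B⊆C b b∈B)) (sym (∈⁅0F⁆ (A⊆C a a∈A)))) b∈B)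

path₃-compValue : CompValue (path 3) 0 ⁅ 1F ⁆ ⁅ 0F ⁆ 1
path₃-compValue = path₃-component , inj₂ (path₃-unsplittable , refl)

path₃-isCg : IsCg (path 3) 0 2
path₃-isCg = (⁅ 1F ⁆ , ⁅ 0F ⁆ , 1 , path₃-cut , path₃-compValue , refl)
           , λ _ _ _ cut value →
               +-mono-≤ (goodCut⇒0<∣X∣ _ path₃-connected cut) (compValue⇒0<w _ value)

path₃-isTg : IsTg (path 3) 0 1
path₃-isTg = from-yes (diagnosable? (path 3) 0 1)
           , λ _ diag → ≤-pred (diagnosable⇒<cutValue _ diag path₃-cut path₃-compValue)

theorem4p1 : ((n : ℕ) (G : Graph n) (g : ℕ) → Connected G → KappaExists G g →
    (t c : ℕ) → IsTg G g t → IsCg G g c →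
    (t + 1 ≤ c) × (t + g + 2 ≤ n))
    ×
    Σ ℕ (λ n → Σ (Graph n) (λ G → Σ ℕ (λ g → Σ ℕ (λ t → Σ ℕ (λ c →
    Connected G × KappaExists G g × IsTg G g t × IsCg G g c ×
    t ≡ (c ∸ 1) ⊓ (n ∸ g ∸ 2))))))
theorem4p1 =
  -- The cut and component are read off the minimiser in IsCg.
  (λ n G g _ _ t c (diag , _) ((X , C , w , cut , value , c≡∣X∣+w) , _) →
     subst (t + 1 ≤_) (sym c≡∣X∣+w)
       (subst (_≤ ∣ X ∣ + w) (+-comm 1 t) (diagnosable⇒<cutValue G diag cut value)) ,
     diagnosable⇒t+g+2≤n G diag cut (proj₁ value)) ,
  (3 , path 3 , 0 , 1 , 2 , path₃-connected , (⁅ 1F ⁆ , path₃-cut) , path₃-isTg , path₃-isCg , refl)
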